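{- Let $a\geq 3$ and $b\geq 1$ be integers. Then there are only finitely many positive integers $n$ satisfying $$\sigma_a(n)-n^a=\sum_{d\mid n,\ d<n} d^a = bn.$$
   Context: For positive integers $n,a$, $\sigma_a(n)=\sum_{d\mid n} d^a$ is the sum of the $a$-th powers of the positive divisors of $n$. -}

module Defs where

open import Data.Nat using (ℕ; zero; suc; _+_; _^_)
open import Data.Nat.Divisibility using (_∣_; _∣?_)
open import Relation.Nullary using (yes; no)

divPowSumUpTo : ℕ → ℕ → ℕ → ℕ
divPowSumUpTo a n zero = 0
divPowSumUpTo a n (suc k) with suc k ∣? n
... | yes _ = suc k ^ a + divPowSumUpTo a n k
... | no  _ = divPowSumUpTo a n k

-- σ_a(n) = Σ_{d ∣ n} d^a  (for positive n the positive divisors lie in 1..n)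
σ : ℕ → ℕ → ℕ
σ a n = divPowSumUpTo a n n

{-# OPTIONS --safe #-}
module Submission where

open import Defs
open import Data.Nat using (ℕ; _≤_; _*_; _∸_; _^_; NonZero)
open import Data.Product using (∃-syntax)
open import Relation.Binary.PropositionalEquality using (_≡_)

open import Data.Nat using (zero; suc; pred; _+_; _<_; z≤n; s≤s; >-nonZero; >-nonZero⁻¹; n>1⇒nonTrivial)
open import Data.Nat.Properties
open import Data.Nat.Divisibility
  using (_∣_; _∣?_; ∣-refl; quotient; quotient-∣; quotient≢0; quotient-<; m∣n⇒n≡quotient*m)
open import Data.Product using (_×_; _,_)
open import Data.Sum using (_⊎_; inj₁; inj₂)
open import Data.Empty using (⊥-elim)
open import Relation.Nullary using (yes; no)
open import Relation.Binary.PropositionalEquality using (refl; sym; trans; cong; cong₂)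

-- Put S = σ_a(n) − n^a. If n has no divisor d with 1 < d < n, then S ≤ 1 and S = b n
-- forces n ≤ 1. Otherwise n = q d with 1 ≤ q, d < n, and both q^a and d^a are terms of S,
-- so n^a = q^a d^a ≤ S² = b² n². Since a ≥ 3 this gives n³ ≤ b² n², i.e. n ≤ b².

^-distribʳ-* : ∀ m n o → (n * o) ^ m ≡ n ^ m * o ^ m
^-distribʳ-* zero    n o = refl
^-distribʳ-* (suc m) n o = trans (cong ((n * o) *_) (^-distribʳ-* m n o))
                                 ([m*n]*[o*p]≡[m*o]*[n*p] n o (n ^ m) (o ^ m))

properDivPowSum : ℕ → ℕ → ℕ
properDivPowSum a n = divPowSumUpTo a n (pred n)

σ∸^≡properDivPowSum : ∀ a n .{{_ : NonZero n}} → σ a n ∸ n ^ a ≡ properDivPowSum a n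
σ∸^≡properDivPowSum a (suc k) with suc k ∣? suc k
... | yes _ = m+n∸m≡n (suc k ^ a) (divPowSumUpTo a (suc k) k)
... | no ¬n∣n = ⊥-elim (¬n∣n ∣-refl)

∣⇒^≤divPowSumUpTo : ∀ a {n d} k → d ∣ n → 1 ≤ d → d ≤ k → d ^ a ≤ divPowSumUpTo a n k
∣⇒^≤divPowSumUpTo a zero d∣n 1≤d d≤0 = ⊥-elim (<-irrefl refl (≤-trans 1≤d d≤0))
∣⇒^≤divPowSumUpTo a {n} (suc k) d∣n 1≤d d≤1+k with suc k ∣? n | m≤n⇒m<n∨m≡n d≤1+k
... | yes _      | inj₂ refl      = m≤m+n _ _
... | yes _      | inj₁ (s≤s d≤k) = ≤-trans (∣⇒^≤divPowSumUpTo a k d∣n 1≤d d≤k) (m≤n+m _ _)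
... | no ¬1+k∣n  | inj₂ refl      = ⊥-elim (¬1+k∣n d∣n)
... | no _       | inj₁ (s≤s d≤k) = ∣⇒^≤divPowSumUpTo a k d∣n 1≤d d≤k

divPowSumUpTo≤1⊎nontrivialDivisor : ∀ a n k →
  divPowSumUpTo a n k ≤ 1 ⊎ ∃[ d ] (d ∣ n × 1 < d × d ≤ k)
divPowSumUpTo≤1⊎nontrivialDivisor a n zero = inj₁ z≤n
divPowSumUpTo≤1⊎nontrivialDivisor a n (suc k) with suc k ∣? n
divPowSumUpTo≤1⊎nontrivialDivisor a n (suc zero)    | yes _   = inj₁ (≤-reflexive (cong (_+ 0) (^-zeroˡ a)))
divPowSumUpTo≤1⊎nontrivialDivisor a n (suc (suc k)) | yes 2+k∣n = inj₂ (suc (suc k) , 2+k∣n , s≤s (s≤s z≤n) , ≤-refl)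
... | no _ with divPowSumUpTo≤1⊎nontrivialDivisor a n k
...   | inj₁ S≤1                  = inj₁ S≤1
...   | inj₂ (d , d∣n , 1<d , d≤k) = inj₂ (d , d∣n , 1<d , m≤n⇒m≤1+n d≤k)

properDivPowSum≤1⊎nontrivialDivisor : ∀ a n .{{_ : NonZero n}} →
  properDivPowSum a n ≤ 1 ⊎ ∃[ d ] (d ∣ n × 1 < d × d < n)
properDivPowSum≤1⊎nontrivialDivisor a (suc k) with divPowSumUpTo≤1⊎nontrivialDivisor a (suc k) k
... | inj₁ S≤1                  = inj₁ S≤1
... | inj₂ (d , d∣n , 1<d , d≤k) = inj₂ (d , d∣n , 1<d , s≤s d≤k)

^≤properDivPowSum² : ∀ a {n d} .{{_ : NonZero n}} → d ∣ n → 1 < d → d < n →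
  n ^ a ≤ properDivPowSum a n * properDivPowSum a n
^≤properDivPowSum² a {n@(suc k)} {d} d∣n 1<d d<n = begin
  n ^ a          ≡⟨ cong (_^ a) (m∣n⇒n≡quotient*m d∣n) ⟩
  (q * d) ^ a    ≡⟨ ^-distribʳ-* a q d ⟩
  q ^ a * d ^ a  ≤⟨ *-mono-≤ q^a≤S d^a≤S ⟩
  S * S          ∎
  where
  open ≤-Reasoning
  instance _ = n>1⇒nonTrivial 1<d
  q = quotient d∣n
  S = properDivPowSum a n
  q^a≤S : q ^ a ≤ S
  q^a≤S = ∣⇒^≤divPowSumUpTo a k (quotient-∣ d∣n) (>-nonZero⁻¹ q {{quotient≢0 d∣n}}) (≤-pred (quotient-< d∣n))
  d^a≤S : d ^ a ≤ S
  d^a≤S = ∣⇒^≤divPowSumUpTo a k d∣n (<⇒≤ 1<d) (≤-pred d<n)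

cube≤c*square⇒≤c : ∀ {a c} n .{{_ : NonZero n}} → 3 ≤ a → n ^ a ≤ c * (n * n) → n ≤ c
cube≤c*square⇒≤c {a} {c} n 3≤a n^a≤c*n² = *-cancelʳ-≤ n c (n * n) {{m*n≢0 n n}} (begin
  n * (n * n)    ≡⟨ cong (λ m → n * (n * m)) (sym (*-identityʳ n)) ⟩
  n ^ 3          ≤⟨ ^-monoʳ-≤ n 3≤a ⟩
  n ^ a          ≤⟨ n^a≤c*n² ⟩
  c * (n * n)    ∎)
  where open ≤-Reasoning

properDivPowSum≡b*n⇒≤b² : ∀ a b n .{{_ : NonZero n}} → 3 ≤ a → 1 ≤ b →
  properDivPowSum a n ≡ b * n → n ≤ b * b
properDivPowSum≡b*n⇒≤b² a b n 3≤a 1≤b S≡bn with properDivPowSum≤1⊎nontrivialDivisor a n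
... | inj₁ S≤1 = begin
  n        ≤⟨ m≤n*m n b {{>-nonZero 1≤b}} ⟩
  b * n    ≡⟨ sym S≡bn ⟩
  properDivPowSum a n ≤⟨ S≤1 ⟩
  1        ≤⟨ 1≤b ⟩
  b        ≤⟨ m≤m*n b b {{>-nonZero 1≤b}} ⟩
  b * b    ∎
  where open ≤-Reasoning
... | inj₂ (d , d∣n , 1<d , d<n) = cube≤c*square⇒≤c n 3≤a (begin
  n ^ a                                      ≤⟨ ^≤properDivPowSum² a d∣n 1<d d<n ⟩
  properDivPowSum a n * properDivPowSum a n  ≡⟨ cong₂ _*_ S≡bn S≡bn ⟩
  (b * n) * (b * n)                          ≡⟨ [m*n]*[o*p]≡[m*o]*[n*p] b n b n ⟩
  (b * b) * (n * n)                          ∎)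
  where open ≤-Reasoning

theorem3 : (a b : ℕ) → 3 ≤ a → 1 ≤ b →
    ∃[ N ] ((n : ℕ) → NonZero n → σ a n ∸ n ^ a ≡ b * n → n ≤ N)
theorem3 a b 3≤a 1≤b = b * b , λ n n≢0 eq →
  properDivPowSum≡b*n⇒≤b² a b n {{n≢0}} 3≤a 1≤b (trans (sym (σ∸^≡properDivPowSum a n {{n≢0}})) eq)
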